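{- For any nonnegative integers $n$ and $k$ with $n \ge 6k+4$, $\Delta(n,k) > 0$.
   Context: For integers $n \ge 1$ and $k \ge 0$, $JL_{n,k} = \sum_{i=k}^{\lfloor n/2 \rfloor} \frac{n}{n-i} \binom{n-i}{i} \binom{i}{k}$ (empty sum $=0$), and $\Delta(n,k) = JL_{n,k+1} - JL_{n,k}$. -}

module Defs where

open import Data.Nat using (ℕ; zero; suc; _+_; _*_; _∸_; _/_)
open import Data.Nat.Combinatorics using (_C_)
open import Data.Integer using (+_)
open import Data.Rational using (ℚ; 0ℚ; _-_) renaming (_+_ to _+ℚ_; _/_ to _/ℚ_)

-- The summand  n/(n-i) * C(n-i,i) * C(i,k)  as a rational number.
-- The case n - i = 0 never arises in JL (i ≤ ⌊n/2⌋ < n for n ≥ 1);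
-- it is set to 0 only to make the definition total.
term : ℕ → ℕ → ℕ → ℚ
term n k i with n ∸ i
... | zero  = 0ℚ
... | suc m = (+ (n * ((suc m) C i) * (i C k))) /ℚ (suc m)

sumFrom : ℕ → ℕ → (ℕ → ℚ) → ℚ
sumFrom a zero    f = 0ℚ
sumFrom a (suc l) f = f a +ℚ sumFrom (suc a) l f

-- JL_{n,k} = Σ_{i=k}^{⌊n/2⌋} n/(n-i) C(n-i,i) C(i,k)   (empty sum = 0)
JL : ℕ → ℕ → ℚ
JL n k = sumFrom k (suc (n / 2) ∸ k) (term n k)

Δ : ℕ → ℕ → ℚ
Δ n k = JL n (suc k) - JL n k

{-# OPTIONS --safe #-}

-- JL_{n,k} is the coefficient of xᵏ in the Lucas polynomial L_n(1 + x), and L_{n+2} = L_{n+1} + x L_n gives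
-- Σ_N JL_{N+2k,k} tᴺ = (2 − t)/(1 − t − t²)^{k+1}, i.e. JL_{N+2k,k} = 2 c_{k+1}(N) − c_{k+1}(N − 1), where
-- c_K(m) is the coefficient of tᵐ in (1 − t − t²)^(−K).  As c_{k+2}(m) = c_{k+2}(m − 1) + c_{k+2}(m − 2) + c_{k+1}(m),
-- the claim becomes 2 c(T − 1) + 2 c(T + 2) < 3 c(T) + 3 c(T + 1) for c = c_{k+2} and T = n − 2k − 2.
-- Eliminating c(T − 1) and c(T + 2) by the holonomic recurrence (m + 1) c(m + 1) = (m + K) c(m) + (m + 2K − 1) c(m − 1)
-- leaves an upper bound on c(T + 1)/c(T) to prove.  Log-concavity c(m − 1) c(m + 1) ≤ c(m)² gives one; it is
-- propagated two indices at a time by polynomial certificates, and T ≥ 4k + 2 makes it strong enough.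

module Submission where

-- The development uses ℕ's _<_, whereas the theorem is stated with ℚ's; hence the two submodules.
module Natural where

  open import Data.Nat using (ℕ; zero; suc; _+_; _*_; _∸_; _≤_; _<_; z≤n; s≤s; s<s; s<s⁻¹; z<s; _/_; NonZero)
  open import Data.Nat.Properties
  open import Data.Nat.Combinatorics using (_C_; nCk+nC[k+1]≡[n+1]C[k+1])
  open import Data.Nat.DivMod using (m*n/n≡m; /-monoˡ-≤; m/n≤m)
  open import Data.Nat.Tactic.RingSolver using (solve-∀)
  open import Data.Product using (proj₁; proj₂)
  open import Data.Unit using (tt)
  open import Relation.Nullary using (¬_)
  open import Relation.Binary.PropositionalEquality

  -- Unlike _C_, this satisfies Pascal's rule definitionally (C≡binomial).
  binomial : ℕ → ℕ → ℕ
  binomial n       zero    = 1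
  binomial zero    (suc k) = 0
  binomial (suc n) (suc k) = binomial n k + binomial n (suc k)

  C≡binomial : ∀ n k → n C k ≡ binomial n k
  C≡binomial n       zero    = refl
  C≡binomial zero    (suc k) = refl
  C≡binomial (suc n) (suc k) =
    trans (sym (nCk+nC[k+1]≡[n+1]C[k+1] n k)) (cong₂ _+_ (C≡binomial n k) (C≡binomial n (suc k)))

  binomial-< : ∀ {n k} → n < k → binomial n k ≡ 0
  binomial-< {zero}  {suc k} _         = refl
  binomial-< {suc n} {suc k} (s≤s n<k) = cong₂ _+_ (binomial-< n<k) (binomial-< (m<n⇒m<1+n n<k))

  binomial-1 : ∀ n → binomial n 1 ≡ n
  binomial-1 zero    = refl
  binomial-1 (suc n) = cong suc (binomial-1 n)

  binomial-absorb : ∀ n k → suc k * binomial (suc n) (suc k) ≡ suc n * binomial n k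
  binomial-absorb zero    zero    = refl
  binomial-absorb zero    (suc k) = *-zeroʳ (2 + k)
  binomial-absorb (suc n) zero    =
    trans (*-identityˡ _) (trans (cong suc (binomial-1 (suc n))) (sym (*-identityʳ _)))
  binomial-absorb (suc n) (suc k) = begin
    (2 + k) * (B + B′)                                 ≡⟨ split k B B′ ⟩
    (suc k * B + B) + (2 + k) * B′                     ≡⟨ cong₂ (λ x y → (x + B) + y) (binomial-absorb n k) (binomial-absorb n (suc k)) ⟩
    (suc n * binomial n k + B) + suc n * binomial n (suc k) ≡⟨ merge n (binomial n k) (binomial n (suc k)) ⟩
    (2 + n) * B                                        ∎
    where
    open ≡-Reasoning
    B  = binomial (suc n) (suc k)
    B′ = binomial (suc n) (2 + k)
    split : ∀ k x y → (2 + k) * (x + y) ≡ (suc k * x + x) + (2 + k) * y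
    split = solve-∀
    merge : ∀ n x y → (suc n * x + (x + y)) + suc n * y ≡ (2 + n) * (x + y)
    merge = solve-∀

  -- lucas (n ∸ i) i = n/(n − i) · C(n − i, i), the coefficient of xⁱ in L_n (lucas-summand); lucas 0 0 = L₀ = 2.
  lucas : ℕ → ℕ → ℕ
  lucas zero    zero    = 2
  lucas zero    (suc i) = 0
  lucas (suc p) zero    = 1
  lucas (suc p) (suc i) = binomial (suc p) (suc i) + binomial p i

  lucas-pascal : ∀ p i → lucas (suc p) (suc i) ≡ lucas p (suc i) + lucas p i
  lucas-pascal zero    zero    = refl
  lucas-pascal zero    (suc i) = refl
  lucas-pascal (suc p) zero    = cong (_+ 1) (+-comm 1 (binomial (suc p) 1))
  lucas-pascal (suc p) (suc i) = shuffle (binomial p i) (binomial p (suc i)) (binomial (suc p) (2 + i))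
    where
    shuffle : ∀ x y z → ((x + y) + z) + (x + y) ≡ (z + y) + ((x + y) + x)
    shuffle = solve-∀

  lucas-< : ∀ {p i} → p < i → lucas p i ≡ 0
  lucas-< {zero}  {suc i} _         = refl
  lucas-< {suc p} {suc i} (s≤s p<i) = cong₂ _+_ (binomial-< (s≤s p<i)) (binomial-< p<i)

  lucas-summand : ∀ m i → (suc m + i) * binomial (suc m) i ≡ suc m * lucas (suc m) i
  lucas-summand m zero    = cong (_* 1) (+-identityʳ (suc m))
  lucas-summand m (suc i) = begin
    (suc m + suc i) * B                   ≡⟨ *-distribʳ-+ B (suc m) (suc i) ⟩
    suc m * B + suc i * B                 ≡⟨ cong (suc m * B +_) (binomial-absorb m i) ⟩
    suc m * B + suc m * binomial m i      ≡⟨ *-distribˡ-+ (suc m) B (binomial m i) ⟨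
    suc m * (B + binomial m i)            ∎
    where
    open ≡-Reasoning
    B = binomial (suc m) (suc i)

  lucas-beyond-half : ∀ n x → n / 2 < x → lucas (n ∸ x) x ≡ 0
  lucas-beyond-half n x n/2<x = lucas-< (≰⇒> (λ x≤n∸x → <⇒≱ n/2<x (half x≤n∸x)))
    where
    half : x ≤ n ∸ x → x ≤ n / 2
    half x≤n∸x =
      subst (_≤ n / 2) (m*n/n≡m x 2) (/-monoˡ-≤ 2 (subst₂ _≤_ (double x) (m+[n∸m]≡n x≤n) (+-monoʳ-≤ x x≤n∸x)))
      where
      x≤n : x ≤ n
      x≤n = ≤-trans x≤n∸x (m∸n≤m n x)
      double : ∀ x → x + x ≡ x * 2
      double = solve-∀

  sumℕ : ℕ → ℕ → (ℕ → ℕ) → ℕ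
  sumℕ a zero    f = 0
  sumℕ a (suc l) f = f a + sumℕ (suc a) l f

  sumℕ-cong : ∀ a l {f g} → (∀ x → f x ≡ g x) → sumℕ a l f ≡ sumℕ a l g
  sumℕ-cong a zero    f≗g = refl
  sumℕ-cong a (suc l) f≗g = cong₂ _+_ (f≗g a) (sumℕ-cong (suc a) l f≗g)

  sumℕ-shift : ∀ a l f → sumℕ (suc a) l f ≡ sumℕ a l (λ x → f (suc x))
  sumℕ-shift a zero    f = refl
  sumℕ-shift a (suc l) f = cong (f (suc a) +_) (sumℕ-shift (suc a) l f)

  sumℕ-vanishing : ∀ a l f → (∀ x → a ≤ x → f x ≡ 0) → sumℕ a l f ≡ 0
  sumℕ-vanishing a zero    f vanish = refl
  sumℕ-vanishing a (suc l) f vanish =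
    cong₂ _+_ (vanish a ≤-refl) (sumℕ-vanishing (suc a) l f (λ x a<x → vanish x (<⇒≤ a<x)))

  sumℕ-from-0 : ∀ a l f → (∀ x → x < a → f x ≡ 0) → sumℕ a l f ≡ sumℕ 0 (a + l) f
  sumℕ-from-0 zero    l f vanish = refl
  sumℕ-from-0 (suc a) l f vanish = begin
    sumℕ (suc a) l f                          ≡⟨ sumℕ-shift a l f ⟩
    sumℕ a l (λ x → f (suc x))                ≡⟨ sumℕ-from-0 a l (λ x → f (suc x)) (λ x x<a → vanish (suc x) (s<s x<a)) ⟩
    sumℕ 0 (a + l) (λ x → f (suc x))          ≡⟨ sumℕ-shift 0 (a + l) f ⟨
    sumℕ 1 (a + l) f                          ≡⟨ cong (_+ sumℕ 1 (a + l) f) (vanish 0 z<s) ⟨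
    f 0 + sumℕ 1 (a + l) f                    ∎
    where open ≡-Reasoning

  sumℕ-truncate : ∀ a h l f → (∀ x → a + h ≤ x → f x ≡ 0) → h ≤ l → sumℕ a l f ≡ sumℕ a h f
  sumℕ-truncate a zero    l       f vanish _ =
    sumℕ-vanishing a l f (λ x a≤x → vanish x (subst (_≤ x) (sym (+-identityʳ a)) a≤x))
  sumℕ-truncate a (suc h) (suc l) f vanish (s≤s h≤l) =
    cong (f a +_) (sumℕ-truncate (suc a) h l f (λ x a+h<x → vanish x (subst (_≤ x) (sym (+-suc a h)) a+h<x)) h≤l)

  -- Σ_{j ≤ p} lucas (p ∸ j) (i + j) · w (i + j) (lucasDiag-sum), defined by recursion so that the
  -- recurrence of the Lucas polynomials becomes provable by induction (jl-rec-suc).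
  lucasDiag : (ℕ → ℕ) → ℕ → ℕ → ℕ
  lucasDiag w zero    i = lucas zero i * w i
  lucasDiag w (suc p) i = lucas (suc p) i * w i + lucasDiag w p (suc i)

  lucasDiag-shift : ∀ w p i → lucasDiag w (suc p) (suc i) ≡ lucasDiag w p (suc i) + lucasDiag (λ x → w (suc x)) p i
  lucasDiag-shift w zero i = begin
    lucas 1 (suc i) * w (suc i) + 0            ≡⟨ +-identityʳ _ ⟩
    lucas 1 (suc i) * w (suc i)                ≡⟨ cong (_* w (suc i)) (lucas-pascal 0 i) ⟩
    (lucas 0 (suc i) + lucas 0 i) * w (suc i)  ≡⟨ *-distribʳ-+ (w (suc i)) (lucas 0 (suc i)) (lucas 0 i) ⟩
    lucas 0 (suc i) * w (suc i) + lucas 0 i * w (suc i) ∎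
    where open ≡-Reasoning
  lucasDiag-shift w (suc p) i = begin
    lucas (2 + p) (suc i) * w (suc i) + lucasDiag w (suc p) (2 + i)
      ≡⟨ cong₂ _+_ (cong (_* w (suc i)) (lucas-pascal (suc p) i)) (lucasDiag-shift w p (suc i)) ⟩
    (lucas (suc p) (suc i) + lucas (suc p) i) * w (suc i) + (lucasDiag w p (2 + i) + lucasDiag (λ x → w (suc x)) p (suc i))
      ≡⟨ regroup (lucas (suc p) (suc i)) (lucas (suc p) i) (w (suc i)) _ _ ⟩
    (lucas (suc p) (suc i) * w (suc i) + lucasDiag w p (2 + i)) + (lucas (suc p) i * w (suc i) + lucasDiag (λ x → w (suc x)) p (suc i)) ∎
    where
    open ≡-Reasoning
    regroup : ∀ a b c d e → (a + b) * c + (d + e) ≡ (a * c + d) + (b * c + e)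
    regroup = solve-∀

  lucasDiag-+ : ∀ v w p i → lucasDiag (λ x → v x + w x) p i ≡ lucasDiag v p i + lucasDiag w p i
  lucasDiag-+ v w zero    i = *-distribˡ-+ (lucas zero i) (v i) (w i)
  lucasDiag-+ v w (suc p) i = begin
    lucas (suc p) i * (v i + w i) + lucasDiag (λ x → v x + w x) p (suc i)
      ≡⟨ cong₂ _+_ (*-distribˡ-+ (lucas (suc p) i) (v i) (w i)) (lucasDiag-+ v w p (suc i)) ⟩
    (lucas (suc p) i * v i + lucas (suc p) i * w i) + (lucasDiag v p (suc i) + lucasDiag w p (suc i))
      ≡⟨ +-+-comm (lucas (suc p) i * v i) _ _ _ ⟩
    (lucas (suc p) i * v i + lucasDiag v p (suc i)) + (lucas (suc p) i * w i + lucasDiag w p (suc i)) ∎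
    where
    open ≡-Reasoning
    +-+-comm : ∀ a b c d → (a + b) + (c + d) ≡ (a + c) + (b + d)
    +-+-comm = solve-∀

  lucasDiag-sum : ∀ w p i → lucasDiag w p i ≡ sumℕ i (suc p) (λ x → lucas (p + i ∸ x) x * w x)
  lucasDiag-sum w zero    i = begin
    lucas 0 i * w i                       ≡⟨ cong (λ p → lucas p i * w i) (n∸n≡0 i) ⟨
    lucas (i ∸ i) i * w i                 ≡⟨ +-identityʳ _ ⟨
    lucas (i ∸ i) i * w i + 0             ∎
    where open ≡-Reasoning
  lucasDiag-sum w (suc p) i = cong₂ _+_
    (cong (λ q → lucas q i * w i) (sym (m+n∸n≡m (suc p) i)))
    (trans (lucasDiag-sum w p (suc i)) (sumℕ-cong (suc i) (suc p) (λ x → cong (λ q → lucas (q ∸ x) x * w x) (+-suc p i))))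

  jl : ℕ → ℕ → ℕ
  jl n k = lucasDiag (λ i → binomial i k) n 0

  jl-sum : ∀ n k → jl n k ≡ sumℕ 0 (suc n) (λ i → lucas (n ∸ i) i * binomial i k)
  jl-sum n k = trans (lucasDiag-sum (λ i → binomial i k) n 0)
                     (sumℕ-cong 0 (suc n) (λ x → cong (λ q → lucas (q ∸ x) x * binomial x k) (+-identityʳ n)))

  JL-range-sum≡jl : ∀ n k → sumℕ k (suc (n / 2) ∸ k) (λ i → lucas (n ∸ i) i * binomial i k) ≡ jl n k
  JL-range-sum≡jl n k = begin
    sumℕ k (suc (n / 2) ∸ k) F            ≡⟨ sumℕ-from-0 k _ F below-k ⟩
    sumℕ 0 (k + (suc (n / 2) ∸ k)) F      ≡⟨ sumℕ-truncate 0 (suc (n / 2)) _ F beyond-half (m≤n+m∸n (suc (n / 2)) k) ⟩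
    sumℕ 0 (suc (n / 2)) F                ≡⟨ sumℕ-truncate 0 (suc (n / 2)) (suc n) F beyond-half (s≤s (m/n≤m n 2)) ⟨
    sumℕ 0 (suc n) F                      ≡⟨ jl-sum n k ⟨
    jl n k                                ∎
    where
    open ≡-Reasoning
    F = λ i → lucas (n ∸ i) i * binomial i k
    below-k : ∀ x → x < k → F x ≡ 0
    below-k x x<k = trans (cong (lucas (n ∸ x) x *_) (binomial-< x<k)) (*-zeroʳ (lucas (n ∸ x) x))
    beyond-half : ∀ x → suc (n / 2) ≤ x → F x ≡ 0
    beyond-half x n/2<x = cong (_* binomial x k) (lucas-beyond-half n x n/2<x)

  jl-rec-zero : ∀ n → jl (2 + n) 0 ≡ jl (1 + n) 0 + jl n 0
  jl-rec-zero n = begin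
    1 * 1 + lucasDiag (λ _ → 1) (suc n) 1               ≡⟨ cong (1 * 1 +_) (lucasDiag-shift (λ _ → 1) n 0) ⟩
    1 * 1 + (lucasDiag (λ _ → 1) n 1 + jl n 0)          ≡⟨ +-assoc (1 * 1) (lucasDiag (λ _ → 1) n 1) _ ⟨
    (1 * 1 + lucasDiag (λ _ → 1) n 1) + jl n 0          ∎
    where open ≡-Reasoning

  jl-rec-suc : ∀ n k → jl (2 + n) (suc k) ≡ jl (1 + n) (suc k) + (jl n k + jl n (suc k))
  jl-rec-suc n k = begin
    1 * 0 + lucasDiag w (suc n) 1                                ≡⟨ cong (1 * 0 +_) (lucasDiag-shift w n 0) ⟩
    1 * 0 + (lucasDiag w n 1 + lucasDiag (λ x → w (suc x)) n 0)  ≡⟨ +-assoc (1 * 0) (lucasDiag w n 1) _ ⟨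
    jl (1 + n) (suc k) + lucasDiag (λ x → w (suc x)) n 0         ≡⟨ cong (jl (1 + n) (suc k) +_) (lucasDiag-+ (λ i → binomial i k) w n 0) ⟩
    jl (1 + n) (suc k) + (jl n k + jl n (suc k))                 ∎
    where
    open ≡-Reasoning
    w = λ i → binomial i (suc k)

  jl-below : ∀ n k → n < 2 * k → jl n k ≡ 0
  jl-below zero          (suc k) _ = refl
  jl-below (suc zero)    (suc k) _ = refl
  jl-below (suc (suc n)) (suc k) n+2<2k+2 = begin
    jl (2 + n) (suc k)                              ≡⟨ jl-rec-suc n k ⟩
    jl (1 + n) (suc k) + (jl n k + jl n (suc k))    ≡⟨ cong₂ _+_ (jl-below (suc n) (suc k) 1+n<)
                                                         (cong₂ _+_ (jl-below n k n<2k) (jl-below n (suc k) (<-trans (n<1+n n) 1+n<))) ⟩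
    0                                               ∎
    where
    open ≡-Reasoning
    n<2k : n < 2 * k
    n<2k = s<s⁻¹ (s<s⁻¹ (subst (2 + n <_) (*-suc 2 k) n+2<2k+2))
    1+n< : 1 + n < 2 * suc k
    1+n< = <-trans (n<1+n (1 + n)) n+2<2k+2

  jl-diagonal : ∀ k → jl (2 * k) k ≡ 2
  jl-diagonal zero    = refl
  jl-diagonal (suc k) = begin
    jl (2 * suc k) (suc k)                                        ≡⟨ cong (λ n → jl n (suc k)) (*-suc 2 k) ⟩
    jl (2 + 2 * k) (suc k)                                        ≡⟨ jl-rec-suc (2 * k) k ⟩
    jl (1 + 2 * k) (suc k) + (jl (2 * k) k + jl (2 * k) (suc k))  ≡⟨ cong₂ (λ x y → x + (jl (2 * k) k + y))
                                                                        (jl-below (1 + 2 * k) (suc k) (below ≤-refl))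
                                                                        (jl-below (2 * k) (suc k) (below (m<n⇒m<1+n (n<1+n _)))) ⟩
    0 + (jl (2 * k) k + 0)                                        ≡⟨ cong (_+ 0) (jl-diagonal k) ⟩
    2                                                             ∎
    where
    open ≡-Reasoning
    below : ∀ {n} → n < 2 + 2 * k → n < 2 * suc k
    below {n} = subst (n <_) (sym (*-suc 2 k))

  jl-subdiagonal : ∀ k → jl (1 + 2 * k) k ≡ 1 + 2 * k
  jl-subdiagonal zero    = refl
  jl-subdiagonal (suc k) = begin
    jl (1 + 2 * suc k) (suc k)                                              ≡⟨ cong (λ n → jl (suc n) (suc k)) (*-suc 2 k) ⟩
    jl (3 + 2 * k) (suc k)                                                  ≡⟨ jl-rec-suc (1 + 2 * k) k ⟩
    jl (2 + 2 * k) (suc k) + (jl (1 + 2 * k) k + jl (1 + 2 * k) (suc k))  ≡⟨ cong₂ (λ x y → x + (jl (1 + 2 * k) k + y))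
                                                                               (trans (cong (λ n → jl n (suc k)) (sym (*-suc 2 k))) (jl-diagonal (suc k)))
                                                                               (jl-below (1 + 2 * k) (suc k) (subst (1 + 2 * k <_) (sym (*-suc 2 k)) ≤-refl)) ⟩
    2 + (jl (1 + 2 * k) k + 0)                                              ≡⟨ cong (λ x → 2 + (x + 0)) (jl-subdiagonal k) ⟩
    2 + ((1 + 2 * k) + 0)                                                   ≡⟨ cong suc (trans (cong (2 +_) (+-identityʳ (2 * k))) (sym (*-suc 2 k))) ⟩
    1 + 2 * suc k                                                           ∎
    where open ≡-Reasoning

  -- convFib K (2 + m) is the coefficient of tᵐ in (1 − t − t²)^(−K), the K-fold convolution of the Fibonacci
  -- numbers; the two leading zeros make the convolution recurrence hold from index 2 on.
  convFib : ℕ → ℕ → ℕ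
  convFib zero    2             = 1
  convFib zero    _             = 0
  convFib (suc K) 0             = 0
  convFib (suc K) 1             = 0
  convFib (suc K) (suc (suc j)) = convFib (suc K) (suc j) + convFib (suc K) j + convFib K (suc (suc j))

  convFib-2 : ∀ K → convFib K 2 ≡ 1
  convFib-2 zero    = refl
  convFib-2 (suc K) = convFib-2 K

  convFib-3 : ∀ K → convFib K 3 ≡ K
  convFib-3 zero    = refl
  convFib-3 (suc K) = cong₂ (λ x y → x + 0 + y) (convFib-2 K) (convFib-3 K)

  convFib-positive : ∀ K j → 1 ≤ convFib (suc K) (2 + j)
  convFib-positive K zero    = ≤-reflexive (sym (convFib-2 (suc K)))
  convFib-positive K (suc j) =
    ≤-trans (convFib-positive K j) (≤-trans (m≤m+n _ (convFib (suc K) (1 + j))) (m≤m+n _ (convFib K (3 + j))))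

  -- With f_K = (1 − t − t²)^(−K): the coefficients of (1 − t − t²) f_K′ = K (1 + 2t) f_K and of
  -- f_K′ = K (1 + 2t) f_{K+1}; each identity is derived from the other one for the neighbouring K.
  convFib-recurrence : ∀ K j → suc j * convFib (suc K) (3 + j)
                               ≡ (j + suc K) * convFib (suc K) (2 + j) + (j + 2 * K + 1) * convFib (suc K) (1 + j)
  convFib-derivative : ∀ K j → suc j * convFib K (3 + j)
                               ≡ K * convFib (suc K) (2 + j) + 2 * K * convFib (suc K) (1 + j)

  convFib-recurrence K j = begin
    suc j * (c₂ + c₁ + a₃)                          ≡⟨ distrib j c₂ c₁ a₃ ⟩
    suc j * c₂ + suc j * c₁ + suc j * a₃            ≡⟨ cong (suc j * c₂ + suc j * c₁ +_) (convFib-derivative K j) ⟩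
    suc j * c₂ + suc j * c₁ + (K * c₂ + 2 * K * c₁) ≡⟨ collect j K c₂ c₁ ⟩
    (j + suc K) * c₂ + (j + 2 * K + 1) * c₁         ∎
    where
    open ≡-Reasoning
    c₂ = convFib (suc K) (2 + j)
    c₁ = convFib (suc K) (1 + j)
    a₃ = convFib K (3 + j)
    distrib : ∀ j x y z → suc j * (x + y + z) ≡ suc j * x + suc j * y + suc j * z
    distrib = solve-∀
    collect : ∀ j K x y → suc j * x + suc j * y + (K * x + 2 * K * y) ≡ (j + suc K) * x + (j + 2 * K + 1) * y
    collect = solve-∀

  convFib-derivative zero    j             = *-zeroʳ (suc j)
  convFib-derivative (suc K) zero          = begin
    1 * convFib (suc K) 3                          ≡⟨ *-identityˡ _ ⟩
    convFib (suc K) 3                              ≡⟨ convFib-3 (suc K) ⟩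
    suc K                                          ≡⟨ solve-at-one K ⟩
    suc K * 1 + 2 * suc K * 0                      ≡⟨ cong (λ x → suc K * x + 2 * suc K * 0) (convFib-2 (2 + K)) ⟨
    suc K * convFib (2 + K) 2 + 2 * suc K * 0      ∎
    where
    open ≡-Reasoning
    solve-at-one : ∀ K → suc K ≡ suc K * 1 + 2 * suc K * 0
    solve-at-one = solve-∀
  convFib-derivative (suc K) (suc zero)    = begin
    2 * convFib (suc K) 4                                        ≡⟨ convFib-recurrence K 1 ⟩
    (1 + suc K) * convFib (suc K) 3 + (1 + 2 * K + 1) * convFib (suc K) 2
                                                                 ≡⟨ cong₂ (λ x y → (1 + suc K) * x + (1 + 2 * K + 1) * y) (convFib-3 (suc K)) (convFib-2 (suc K)) ⟩
    (1 + suc K) * suc K + (1 + 2 * K + 1) * 1                    ≡⟨ collect K ⟩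
    suc K * (1 + 0 + suc K) + 2 * suc K * 1                      ≡⟨ cong₂ (λ x y → suc K * (x + 0 + y) + 2 * suc K * x) (convFib-2 (suc K)) (convFib-3 (suc K)) ⟨
    suc K * convFib (2 + K) 3 + 2 * suc K * convFib (2 + K) 2    ∎
    where
    open ≡-Reasoning
    collect : ∀ K → (1 + suc K) * suc K + (1 + 2 * K + 1) * 1 ≡ suc K * (1 + 0 + suc K) + 2 * suc K * 1
    collect = solve-∀
  convFib-derivative (suc K) (suc (suc j)) = begin
    (3 + j) * a₅                                                  ≡⟨ convFib-recurrence K (2 + j) ⟩
    (2 + j + suc K) * a₄ + (2 + j + 2 * K + 1) * a₃               ≡⟨ split j K a₄ a₃ ⟩
    (2 + j) * a₄ + suc j * a₃ + (suc K * a₄ + 2 * suc K * a₃)     ≡⟨ cong₂ (λ x y → x + y + (suc K * a₄ + 2 * suc K * a₃))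
                                                                         (convFib-derivative (suc K) (suc j)) (convFib-derivative (suc K) j) ⟩
    suc K * (b₂ + b₁ + a₃) + 2 * suc K * b₂ + (suc K * b₂ + 2 * suc K * b₁) + (suc K * a₄ + 2 * suc K * a₃)
                                                                  ≡⟨ collect K a₄ a₃ b₂ b₁ ⟩
    suc K * (b₂ + b₁ + a₃ + b₂ + a₄) + 2 * suc K * (b₂ + b₁ + a₃) ∎
    where
    open ≡-Reasoning
    a₅ = convFib (suc K) (5 + j)
    a₄ = convFib (suc K) (4 + j)
    a₃ = convFib (suc K) (3 + j)
    b₂ = convFib (2 + K) (2 + j)
    b₁ = convFib (2 + K) (1 + j)
    split : ∀ j K a₄ a₃ → (2 + j + suc K) * a₄ + (2 + j + 2 * K + 1) * a₃
                        ≡ (2 + j) * a₄ + suc j * a₃ + (suc K * a₄ + 2 * suc K * a₃)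
    split = solve-∀
    collect : ∀ K a₄ a₃ b₂ b₁ →
      suc K * (b₂ + b₁ + a₃) + 2 * suc K * b₂ + (suc K * b₂ + 2 * suc K * b₁) + (suc K * a₄ + 2 * suc K * a₃)
      ≡ suc K * (b₂ + b₁ + a₃ + b₂ + a₄) + 2 * suc K * (b₂ + b₁ + a₃)
    collect = solve-∀

  convolution-step : ∀ x y z u v t t′ → x + v ≡ 2 * (v + u + t) → y + u ≡ 2 * v → z + t ≡ 2 * t′ →
                     (x + (z + y)) + (v + u + t) ≡ 2 * ((v + u + t) + v + t′)
  convolution-step x y z u v t t′ hx hy hz = begin
    (x + (z + y)) + (v + u + t)               ≡⟨ regroup x y z u v t ⟩
    (x + v) + (y + u) + (z + t)               ≡⟨ cong₂ _+_ (cong₂ _+_ hx hy) hz ⟩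
    2 * (v + u + t) + 2 * v + 2 * t′          ≡⟨ factor (v + u + t) v t′ ⟩
    2 * ((v + u + t) + v + t′)                ∎
    where
    open ≡-Reasoning
    regroup : ∀ x y z u v t → (x + (z + y)) + (v + u + t) ≡ (x + v) + (y + u) + (z + t)
    regroup = solve-∀
    factor : ∀ a b c → 2 * a + 2 * b + 2 * c ≡ 2 * (a + b + c)
    factor = solve-∀

  jl≡convFib : ∀ k N → jl (N + 2 * k) k + convFib (suc k) (suc N) ≡ 2 * convFib (suc k) (2 + N)
  jl≡convFib k zero = begin
    jl (2 * k) k + 0           ≡⟨ cong (_+ 0) (jl-diagonal k) ⟩
    2                          ≡⟨ cong (2 *_) (convFib-2 (suc k)) ⟨
    2 * convFib (suc k) 2      ∎
    where open ≡-Reasoning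
  jl≡convFib k (suc zero) = begin
    jl (1 + 2 * k) k + convFib (suc k) 2  ≡⟨ cong₂ _+_ (jl-subdiagonal k) (convFib-2 (suc k)) ⟩
    1 + 2 * k + 1                         ≡⟨ double-suc k ⟩
    2 * suc k                             ≡⟨ cong (2 *_) (convFib-3 (suc k)) ⟨
    2 * convFib (suc k) 3                 ∎
    where
    open ≡-Reasoning
    double-suc : ∀ k → 1 + 2 * k + 1 ≡ 2 * suc k
    double-suc = solve-∀
  jl≡convFib zero (suc (suc N)) =
    trans (cong (_+ convFib 1 (3 + N)) (jl-rec-zero (N + 0)))
          (convolution-step (jl (suc N + 0) 0) (jl (N + 0) 0) 0 (convFib 1 (1 + N)) (convFib 1 (2 + N)) 0 0
                            (jl≡convFib zero (suc N)) (jl≡convFib zero N) refl)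
  jl≡convFib (suc k) (suc (suc N)) =
    trans (cong (_+ convFib (2 + k) (3 + N)) (jl-rec-suc (N + 2 * suc k) k))
          (convolution-step (jl (suc N + 2 * suc k) (suc k)) (jl (N + 2 * suc k) (suc k)) (jl (N + 2 * suc k) k)
                            (convFib (2 + k) (1 + N)) (convFib (2 + k) (2 + N)) (convFib (suc k) (3 + N)) (convFib (suc k) (4 + N))
                            (jl≡convFib (suc k) (suc N)) (jl≡convFib (suc k) N)
            (subst (λ n → jl n k + convFib (suc k) (3 + N) ≡ 2 * convFib (suc k) (4 + N))
                   (reindex N k) (jl≡convFib k (2 + N))))
    where
    reindex : ∀ N k → 2 + N + 2 * k ≡ N + 2 * suc k
    reindex = solve-∀

  -- From here on K = κ + 2, so that the coefficient m + 2K − 1 of the recurrence needs no subtraction.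
  Recurrence : ℕ → ℕ → ℕ → ℕ → ℕ → Set
  Recurrence κ m a b c = (2 + m) * c ≡ (m + κ + 3) * b + (m + 2 * κ + 4) * a

  convFib-Recurrence : ∀ κ m → Recurrence κ m (convFib (2 + κ) (2 + m)) (convFib (2 + κ) (3 + m)) (convFib (2 + κ) (4 + m))
  convFib-Recurrence κ m = trans (convFib-recurrence (suc κ) (suc m)) (coefficients m κ _ _)
    where
    coefficients : ∀ m κ x y → (suc m + suc (suc κ)) * x + (suc m + 2 * suc κ + 1) * y ≡ (m + κ + 3) * x + (m + 2 * κ + 4) * y
    coefficients = solve-∀

  -- For a = c(m), b = c(m + 1) with c m = convFib (2 + κ) (2 + m), the recurrence turns this into
  -- log-concavity c(m − 1) c(m + 1) ≤ c(m)²: b/a is at most the positive root of (m + 1) r² = (m + κ + 2) r + (m + 2κ + 3).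
  RatioBound : ℕ → ℕ → ℕ → ℕ → Set
  RatioBound κ m a b = suc m * b * b ≤ (m + 2 * κ + 3) * a * a + (m + κ + 2) * a * b

  ≤-by-certificate : ∀ {x y u v s} w → x + w * u ≡ y + w * v + s → u ≤ v → y ≤ x
  ≤-by-certificate {x} {y} {u} {v} {s} w eq u≤v = +-cancelʳ-≤ (w * u) y x
    (≤-trans (+-monoʳ-≤ y (*-monoʳ-≤ w u≤v)) (subst (y + w * v ≤_) (sym eq) (m≤m+n (y + w * v) s)))

  ≤-by-slack : ∀ {x y} s → y + s ≡ x → y ≤ x
  ≤-by-slack {x} {y} s eq = subst (y ≤_) eq (m≤m+n y s)

  ratioBound-cancel : ∀ {κ m a b} s .{{_ : NonZero s}} → RatioBound κ m (s * a) (s * b) → RatioBound κ m a b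
  ratioBound-cancel {κ} {m} {a} {b} s rb =
    *-cancelˡ-≤ (s * s) {{m*n≢0 s s}} (subst₂ _≤_ (scale-square (suc m) s b) (scale-form (m + 2 * κ + 3) (m + κ + 2) s a b) rb)
    where
    scale-square : ∀ p s b → p * (s * b) * (s * b) ≡ s * s * (p * b * b)
    scale-square = solve-∀
    scale-form : ∀ p q s a b → p * (s * a) * (s * a) + q * (s * a) * (s * b) ≡ s * s * (p * a * a + q * a * b)
    scale-form = solve-∀

  -- c and d are the terms two and three places after a and b, scaled by (m + 2)(m + 3).  Certificates of this
  -- shape exist only for κ ≥ 1 or m ≥ 1, whence the hypothesis 1 ≤ κ + m of ratioBound-two-steps.
  step-certificate₁ : ∀ k m a b →
    let κ = suc k
        X = (m + κ + 3) * b + (m + 2 * κ + 4) * a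
        c = (3 + m) * X
        d = (m + κ + 4) * X + (2 + m) * (m + 2 * κ + 5) * b
        μ = (m + 3) * (m + 2 * κ + 5) * ((m + 3) * (m + 2 * κ + 5))
    in (2 + m + 2 * κ + 3) * c * c + (2 + m + κ + 2) * c * d + μ * (suc m * b * b)
       ≡ suc (2 + m) * d * d + μ * ((m + 2 * κ + 3) * a * a + (m + κ + 2) * a * b)
         + (3 + m) * (m + 2 * κ + 5) * ((3 + m) * a * a + ((2 * κ + 3) * m + (2 * κ + 5) * (κ + 2)) * a * b
                                       + ((m + k + 4) * k + m + 1) * b * b)
  step-certificate₁ = solve-∀

  step-certificate₀ : ∀ n a b →
    let κ = 0
        m = suc n
        X = (m + κ + 3) * b + (m + 2 * κ + 4) * a
        c = (3 + m) * X
        d = (m + κ + 4) * X + (2 + m) * (m + 2 * κ + 5) * b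
        μ = (m + 3) * (m + 4) * ((m + 4) * (m + 5))
    in (2 + m + 2 * κ + 3) * c * c + (2 + m + κ + 2) * c * d + μ * (suc m * b * b)
       ≡ suc (2 + m) * d * d + μ * ((m + 2 * κ + 3) * a * a + (m + κ + 2) * a * b)
         + (m + 3) * (m + 5) * (2 * (m + 4) * a * b + n * b * b)
  step-certificate₀ = solve-∀

  ratioBound-two-steps : ∀ κ m {a b} → 1 ≤ κ + m → RatioBound κ m a b →
    let X = (m + κ + 3) * b + (m + 2 * κ + 4) * a
    in RatioBound κ (2 + m) ((3 + m) * X) ((m + κ + 4) * X + (2 + m) * (m + 2 * κ + 5) * b)
  ratioBound-two-steps (suc k) m       {a} {b} _ =
    ≤-by-certificate ((m + 3) * (m + 2 * suc k + 5) * ((m + 3) * (m + 2 * suc k + 5))) (step-certificate₁ k m a b)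
  ratioBound-two-steps zero    (suc n) {a} {b} _ =
    ≤-by-certificate ((suc n + 3) * (suc n + 4) * ((suc n + 4) * (suc n + 5))) (step-certificate₀ n a b)
  ratioBound-two-steps zero    zero    ()

  ratioBound-step : ∀ κ m {a b c d} → 1 ≤ κ + m → Recurrence κ m a b c → Recurrence κ (1 + m) b c d →
                    RatioBound κ m a b → RatioBound κ (2 + m) c d
  ratioBound-step κ m {a} {b} {c} {d} 1≤κ+m hc hd rb =
    ratioBound-cancel {κ} {2 + m} {c} {d} ((2 + m) * (3 + m))
      (subst₂ (RatioBound κ (2 + m)) scaled-c scaled-d (ratioBound-two-steps κ m 1≤κ+m rb))
    where
    open ≡-Reasoning
    X = (m + κ + 3) * b + (m + 2 * κ + 4) * a
    scaled-c : (3 + m) * X ≡ (2 + m) * (3 + m) * c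
    scaled-c = begin
      (3 + m) * X                  ≡⟨ cong ((3 + m) *_) hc ⟨
      (3 + m) * ((2 + m) * c)      ≡⟨ swap m c ⟩
      (2 + m) * (3 + m) * c        ∎
      where
      swap : ∀ m c → (3 + m) * ((2 + m) * c) ≡ (2 + m) * (3 + m) * c
      swap = solve-∀
    scaled-d : (m + κ + 4) * X + (2 + m) * (m + 2 * κ + 5) * b ≡ (2 + m) * (3 + m) * d
    scaled-d = begin
      (m + κ + 4) * X + (2 + m) * (m + 2 * κ + 5) * b                ≡⟨ cong (λ x → (m + κ + 4) * x + (2 + m) * (m + 2 * κ + 5) * b) hc ⟨
      (m + κ + 4) * ((2 + m) * c) + (2 + m) * (m + 2 * κ + 5) * b    ≡⟨ factor m κ b c ⟩
      (2 + m) * ((1 + m + κ + 3) * c + (1 + m + 2 * κ + 4) * b)      ≡⟨ cong ((2 + m) *_) hd ⟨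
      (2 + m) * ((3 + m) * d)                                        ≡⟨ *-assoc (2 + m) (3 + m) d ⟨
      (2 + m) * (3 + m) * d                                          ∎
      where
      factor : ∀ m κ b c → (m + κ + 4) * ((2 + m) * c) + (2 + m) * (m + 2 * κ + 5) * b
                         ≡ (2 + m) * ((1 + m + κ + 3) * c + (1 + m + 2 * κ + 4) * b)
      factor = solve-∀

  convFib-ratioBound-step : ∀ κ m → 1 ≤ κ + m →
    RatioBound κ m (convFib (2 + κ) (2 + m)) (convFib (2 + κ) (3 + m)) →
    RatioBound κ (2 + m) (convFib (2 + κ) (4 + m)) (convFib (2 + κ) (5 + m))
  convFib-ratioBound-step κ m 1≤κ+m =
    ratioBound-step κ m {convFib (2 + κ) (2 + m)} {convFib (2 + κ) (3 + m)} {convFib (2 + κ) (4 + m)} {convFib (2 + κ) (5 + m)}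
                    1≤κ+m (convFib-Recurrence κ m) (convFib-Recurrence κ (1 + m))

  convFib-ratioBound-suc : ∀ k m → RatioBound (suc k) m (convFib (3 + k) (2 + m)) (convFib (3 + k) (3 + m))
  convFib-ratioBound-suc k zero = subst₂ (RatioBound (suc k) 0) (sym (convFib-2 (3 + k))) (sym (convFib-3 (3 + k)))
    (≤-by-slack (2 * k + 5) (slack k))
    where
    slack : ∀ k → 1 * (3 + k) * (3 + k) + (2 * k + 5) ≡ (0 + 2 * suc k + 3) * 1 * 1 + (0 + suc k + 2) * 1 * (3 + k)
    slack = solve-∀
  convFib-ratioBound-suc k (suc zero) = subst (λ a → RatioBound (suc k) 1 a (convFib (3 + k) 4)) (sym (convFib-3 (3 + k)))
    (ratioBound-cancel {suc k} {1} {3 + k} {convFib (3 + k) 4} 2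
      (subst (RatioBound (suc k) 1 (2 * (3 + k))) (sym twice-c₂) (≤-by-slack (4 * k * (3 + k) * (3 + k)) (slack k))))
    where
    open ≡-Reasoning
    twice-c₂ : 2 * convFib (3 + k) 4 ≡ (3 + k) * (3 + k) + 3 * (3 + k)
    twice-c₂ = begin
      2 * convFib (3 + k) 4                                            ≡⟨ convFib-recurrence (2 + k) 1 ⟩
      (1 + (3 + k)) * convFib (3 + k) 3 + (1 + 2 * (2 + k) + 1) * convFib (3 + k) 2
        ≡⟨ cong₂ (λ x y → (1 + (3 + k)) * x + (1 + 2 * (2 + k) + 1) * y) (convFib-3 (3 + k)) (convFib-2 (3 + k)) ⟩
      (1 + (3 + k)) * (3 + k) + (1 + 2 * (2 + k) + 1) * 1              ≡⟨ collect k ⟩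
      (3 + k) * (3 + k) + 3 * (3 + k)                                  ∎
      where
      collect : ∀ k → (1 + (3 + k)) * (3 + k) + (1 + 2 * (2 + k) + 1) * 1 ≡ (3 + k) * (3 + k) + 3 * (3 + k)
      collect = solve-∀
    slack : ∀ k → let K = 3 + k; B = K * K + 3 * K in
      2 * B * B + 4 * k * K * K ≡ (1 + 2 * suc k + 3) * (2 * K) * (2 * K) + (1 + suc k + 2) * (2 * K) * B
    slack = solve-∀
  convFib-ratioBound-suc k (suc (suc m)) =
    convFib-ratioBound-step (suc k) m (s≤s z≤n) (convFib-ratioBound-suc k m)

  -- For K = 2 the bound fails at m = 1 (the terms are 1, 2, 5, …), so there the induction starts at m = 2, 3.
  convFib-ratioBound : ∀ κ m → RatioBound κ (2 + m) (convFib (2 + κ) (4 + m)) (convFib (2 + κ) (5 + m))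
  convFib-ratioBound zero    zero          = ≤ᵇ⇒≤ _ _ tt
  convFib-ratioBound zero    (suc zero)    = ≤ᵇ⇒≤ _ _ tt
  convFib-ratioBound zero    (suc (suc m)) =
    convFib-ratioBound-step zero (2 + m) (s≤s z≤n) (convFib-ratioBound zero m)
  convFib-ratioBound (suc k) m             = convFib-ratioBound-suc k (2 + m)

  -- The bound on b/a that is equivalent to 2z + 2c < 3a + 3b once z and c are eliminated (threshold-criterion).
  BelowThreshold : ℕ → ℕ → ℕ → ℕ → Set
  BelowThreshold k T a b = (T * T + 3 * T + 4 * k * k + 6 * k + 4) * b + (8 * k * k + 12 * k) * a < (3 * T * T + 9 * T + 2) * a

  threshold-criterion : ∀ k t {z a b c} → Recurrence k t z a b → Recurrence k (1 + t) a b c →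
                        BelowThreshold k (suc t) a b → 2 * z + 2 * c < 3 * a + 3 * b
  threshold-criterion k t {z} {a} {b} {c} hb hc below =
    *-cancelˡ-< P (2 * z + 2 * c) (3 * a + 3 * b) (+-cancelʳ-< (cyT * a) (P * (2 * z + 2 * c)) (P * (3 * a + 3 * b))
      (subst (_< P * (3 * a + 3 * b) + cyT * a) (sym balance) (+-monoʳ-< (P * (3 * a + 3 * b)) below)))
    where
    open ≡-Reasoning
    T   = suc t
    P   = (2 + T) * (T + 2 * k + 3)
    e   = T * T + 3 * T + 4 * k * k + 6 * k + 4
    w   = 8 * k * k + 12 * k
    cyT = 3 * T * T + 9 * T + 2
    L   = 2 * (2 + T) * (T + k + 2) * a
    balance : P * (2 * z + 2 * c) + cyT * a ≡ P * (3 * a + 3 * b) + (e * b + w * a)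
    balance = +-cancelʳ-≡ L _ _ (begin
      P * (2 * z + 2 * c) + cyT * a + L
        ≡⟨ expand-z-c t k z a c ⟩
      2 * (2 + T) * ((t + k + 3) * a + (t + 2 * k + 4) * z) + 2 * (T + 2 * k + 3) * ((2 + T) * c) + cyT * a
        ≡⟨ cong₂ (λ x y → 2 * (2 + T) * x + 2 * (T + 2 * k + 3) * y + cyT * a) (sym hb) hc ⟩
      2 * (2 + T) * ((2 + t) * b) + 2 * (T + 2 * k + 3) * ((1 + t + k + 3) * b + (1 + t + 2 * k + 4) * a) + cyT * a
        ≡⟨ collect-a-b t k a b ⟩
      P * (3 * a + 3 * b) + (e * b + w * a) + L ∎)
      where
      expand-z-c : ∀ t k z a c → let T = suc t in
        (2 + T) * (T + 2 * k + 3) * (2 * z + 2 * c) + (3 * T * T + 9 * T + 2) * a + 2 * (2 + T) * (T + k + 2) * a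
        ≡ 2 * (2 + T) * ((t + k + 3) * a + (t + 2 * k + 4) * z) + 2 * (T + 2 * k + 3) * ((2 + T) * c) + (3 * T * T + 9 * T + 2) * a
      expand-z-c = solve-∀
      collect-a-b : ∀ t k a b → let T = suc t in
        2 * (2 + T) * ((2 + t) * b) + 2 * (T + 2 * k + 3) * ((1 + t + k + 3) * b + (1 + t + 2 * k + 4) * a) + (3 * T * T + 9 * T + 2) * a
        ≡ (2 + T) * (T + 2 * k + 3) * (3 * a + 3 * b) + ((T * T + 3 * T + 4 * k * k + 6 * k + 4) * b + (8 * k * k + 12 * k) * a)
          + 2 * (2 + T) * (T + k + 2) * a
      collect-a-b = solve-∀

  -- cy is 3T² + 9T + 2 − 8k² − 12k expanded with T = 4k + 2 + d; it, D and S have nonnegative coefficients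
  -- because T ≥ 4k + 2.  With e·b = cy·a + U this shows that e² times the ratio bound fails unless a = 0.
  threshold-certificate : ∀ k d a U →
    let T  = 2 + (4 * k + d)
        e  = T * T + 3 * T + 4 * k * k + 6 * k + 4
        cy = 40 * k * k + 24 * k * d + 3 * d * d + 72 * k + 21 * d + 32
        B  = cy * a + U
        D  = 300 + 2160 * k * k * k * k * d + 1980 * k * k * k * d * d + 660 * k * k * d * d * d
               + 95 * k * d * d * d * d + 5 * d * d * d * d * d + 480 * k * k * k * k + 7700 * k * k * k * d
               + 5110 * k * k * d * d + 1120 * k * d * d * d + 80 * d * d * d * d + 1720 * k * k * k
               + 10290 * k * k * d + 4395 * k * d * d + 475 * d * d * d + 2300 * k * k + 6110 * k * d
               + 1260 * d * d + 1360 * k + 1360 * d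
        S  = 220 * k * k * k + 212 * k * k * d + 59 * k * d * d + 5 * d * d * d + 566 * k * k + 355 * k * d
               + 49 * d * d + 482 * k + 148 * d + 136
    in e * e * (T + 2 * k + 3) * a * a + e * (T + k + 2) * a * B + (a * a * D + a * U * S + suc T * U * U)
       ≡ suc T * B * B
  threshold-certificate = solve-∀

  ¬-excess : ∀ q {x y} → q + x ≡ y → 1 ≤ x → ¬ (y ≤ q)
  ¬-excess q {x} q+x≡y 1≤x y≤q = <⇒≱ 1≤x (+-cancelˡ-≤ q x 0 (subst₂ _≤_ (sym q+x≡y) (sym (+-identityʳ q)) y≤q))

  ratioBound⇒belowThreshold : ∀ k d {a b} → 1 ≤ a →
    RatioBound k (2 + (4 * k + d)) a b → BelowThreshold k (2 + (4 * k + d)) a b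
  ratioBound⇒belowThreshold k d {zero}  ()
  ratioBound⇒belowThreshold k d {suc a} {b} _ rb = ≰⇒> threshold⇒⊥
    where
    T   = 2 + (4 * k + d)
    e   = T * T + 3 * T + 4 * k * k + 6 * k + 4
    w   = 8 * k * k + 12 * k
    cyT = 3 * T * T + 9 * T + 2
    cy  = 40 * k * k + 24 * k * d + 3 * d * d + 72 * k + 21 * d + 32
    cyT≡cy+w : ∀ k d a → let T = 2 + (4 * k + d) in
      (3 * T * T + 9 * T + 2) * a ≡ (40 * k * k + 24 * k * d + 3 * d * d + 72 * k + 21 * d + 32) * a + (8 * k * k + 12 * k) * a
    cyT≡cy+w = solve-∀
    scale-lhs : ∀ e p b → e * e * (p * b * b) ≡ p * (e * b) * (e * b)
    scale-lhs = solve-∀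
    scale-rhs : ∀ e p q a b → e * e * (p * a * a + q * a * b) ≡ e * e * p * a * a + e * q * a * (e * b)
    scale-rhs = solve-∀
    threshold⇒⊥ : ¬ (cyT * suc a ≤ e * b + w * suc a)
    threshold⇒⊥ cyT-a≤ = ¬-excess Q (threshold-certificate k d (suc a) U) (s≤s z≤n) scaled
      where
      cy-a≤e-b : cy * suc a ≤ e * b
      cy-a≤e-b = +-cancelʳ-≤ (w * suc a) (cy * suc a) (e * b) (subst (_≤ e * b + w * suc a) (cyT≡cy+w k d (suc a)) cyT-a≤)
      U = proj₁ (m≤n⇒∃[o]m+o≡n cy-a≤e-b)
      B = cy * suc a + U
      B≡e-b : B ≡ e * b
      B≡e-b = proj₂ (m≤n⇒∃[o]m+o≡n cy-a≤e-b)
      Q = e * e * (T + 2 * k + 3) * suc a * suc a + e * (T + k + 2) * suc a * B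
      scaled : suc T * B * B ≤ Q
      scaled = subst₂ _≤_
        (trans (scale-lhs e (suc T) b) (cong (λ x → suc T * x * x) (sym B≡e-b)))
        (trans (scale-rhs e (T + 2 * k + 3) (T + k + 2) (suc a) b)
               (cong (λ x → e * e * (T + 2 * k + 3) * suc a * suc a + e * (T + k + 2) * suc a * x) (sym B≡e-b)))
        (*-monoʳ-≤ (e * e) rb)

  gap-transfer : ∀ x y z a u v → x + z ≡ 2 * a → y + u ≡ 2 * v →
                 2 * z + 2 * (a + z + u + a + v) < 3 * a + 3 * (a + z + u) → y < x
  gap-transfer x y z a u v hx hy gap = +-cancelʳ-< (u + z) y x (begin-strict
    y + (u + z)       ≡⟨ move-y y u z ⟩
    (y + u) + z       ≡⟨ cong (_+ z) hy ⟩
    2 * v + z         <⟨ +-cancelʳ-< (4 * a + 3 * z + 2 * u) (2 * v + z) (2 * a + u) (subst₂ _<_ (expand-lhs a z u v) (expand-rhs a z u) gap) ⟩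
    2 * a + u         ≡⟨ cong (_+ u) hx ⟨
    (x + z) + u       ≡⟨ move-x x z u ⟩
    x + (u + z)       ∎)
    where
    open ≤-Reasoning
    move-y : ∀ y u z → y + (u + z) ≡ (y + u) + z
    move-y = solve-∀
    move-x : ∀ x z u → (x + z) + u ≡ x + (u + z)
    move-x = solve-∀
    expand-lhs : ∀ a z u v → 2 * z + 2 * (a + z + u + a + v) ≡ 2 * v + z + (4 * a + 3 * z + 2 * u)
    expand-lhs = solve-∀
    expand-rhs : ∀ a z u → 3 * a + 3 * (a + z + u) ≡ 2 * a + u + (4 * a + 3 * z + 2 * u)
    expand-rhs = solve-∀

  jl-increasing : ∀ k d → jl (6 * k + 4 + d) k < jl (6 * k + 4 + d) (suc k)
  jl-increasing k d = gap-transfer (jl n (suc k)) (jl n k) z a u v upper lower convFib-gap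
    where
    m = 4 * k + d
    n = 6 * k + 4 + d
    z = convFib (2 + k) (3 + m)
    a = convFib (2 + k) (4 + m)
    u = convFib (suc k) (5 + m)
    v = convFib (suc k) (6 + m)
    reindex₁ : ∀ k d → 2 + (4 * k + d) + 2 * suc k ≡ 6 * k + 4 + d
    reindex₁ = solve-∀
    reindex₀ : ∀ k d → 4 + (4 * k + d) + 2 * k ≡ 6 * k + 4 + d
    reindex₀ = solve-∀
    upper : jl n (suc k) + z ≡ 2 * a
    upper = subst (λ n → jl n (suc k) + z ≡ 2 * a) (reindex₁ k d) (jl≡convFib (suc k) (2 + m))
    lower : jl n k + u ≡ 2 * v
    lower = subst (λ n → jl n k + u ≡ 2 * v) (reindex₀ k d) (jl≡convFib k (4 + m))
    convFib-gap : 2 * z + 2 * (a + z + u + a + v) < 3 * a + 3 * (a + z + u)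
    convFib-gap = threshold-criterion k (1 + m) {z} {a} {b} {c} (convFib-Recurrence k (1 + m)) (convFib-Recurrence k (2 + m))
      (ratioBound⇒belowThreshold k d {a} {b} (convFib-positive (suc k) (2 + m)) (convFib-ratioBound k m))
      where
      b = convFib (2 + k) (5 + m)
      c = convFib (2 + k) (6 + m)

module Embedding where

  open import Defs using (term; sumFrom; JL; Δ)
  open import Data.Nat using (ℕ; zero; suc; _+_; _*_; _∸_; _≤_; _<_; _/_)
  open import Data.Nat.Properties
  open import Data.Nat.Combinatorics using (_C_)
  open import Data.Integer using (+_) renaming (_*_ to _*ℤ_; _+_ to _+ℤ_)
  import Data.Integer.Properties as ℤ
  open import Data.Integer.Tactic.RingSolver renaming (solve-∀ to solveℤ-∀)
  open import Data.Rational using (ℚ; 0ℚ; toℚᵘ) renaming (_+_ to _+ℚ_; _-_ to _-ℚ_; _/_ to _/ℚ_; _<_ to _<ℚ_)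
  import Data.Rational.Properties as ℚ
  open import Data.Rational.Unnormalised using (mkℚᵘ; *≡*) renaming (_+_ to _+ᵘ_)
  import Data.Rational.Unnormalised.Properties as ℚᵘ
  open import Algebra.Properties.Group ℚ.+-0-group using (//-rightDividesʳ)
  open import Data.Product using (_,_)
  open import Relation.Binary.PropositionalEquality
  open Natural

  fromℕ : ℕ → ℚ
  fromℕ n = + n /ℚ 1

  fromℕ-+ : ∀ m n → fromℕ (m + n) ≡ fromℕ m +ℚ fromℕ n
  fromℕ-+ m n = ℚ.toℚᵘ-injective (begin
    toℚᵘ (fromℕ (m + n))                   ≈⟨ ℚ.toℚᵘ-fromℚᵘ (mkℚᵘ (+ (m + n)) 0) ⟩
    mkℚᵘ (+ (m + n)) 0                     ≈⟨ *≡* (trans (cong (_*ℤ + 1) (ℤ.pos-+ m n)) (add-over-1 (+ m) (+ n))) ⟩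
    mkℚᵘ (+ m) 0 +ᵘ mkℚᵘ (+ n) 0           ≈⟨ ℚᵘ.+-cong (ℚ.toℚᵘ-fromℚᵘ (mkℚᵘ (+ m) 0)) (ℚ.toℚᵘ-fromℚᵘ (mkℚᵘ (+ n) 0)) ⟨
    toℚᵘ (fromℕ m) +ᵘ toℚᵘ (fromℕ n)       ≈⟨ ℚ.toℚᵘ-homo-+ (fromℕ m) (fromℕ n) ⟨
    toℚᵘ (fromℕ m +ℚ fromℕ n)              ∎)
    where
    open ℚᵘ.≃-Reasoning
    add-over-1 : ∀ x y → (x +ℤ y) *ℤ + 1 ≡ (x *ℤ + 1 +ℤ y *ℤ + 1) *ℤ + 1
    add-over-1 = solveℤ-∀

  fromℕ-cancel : ∀ m x → + (suc m * x) /ℚ suc m ≡ fromℕ x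
  fromℕ-cancel m x = ℚ.fromℚᵘ-cong {mkℚᵘ (+ (suc m * x)) m} {mkℚᵘ (+ x) 0} (*≡* (begin
    + (suc m * x) *ℤ + 1 ≡⟨ ℤ.*-identityʳ _ ⟩
    + (suc m * x)        ≡⟨ cong +_ (*-comm (suc m) x) ⟩
    + (x * suc m)        ≡⟨ ℤ.pos-* x (suc m) ⟩
    + x *ℤ + suc m       ∎))
    where open ≡-Reasoning

  fromℕ-gap : ∀ {x y} → y < x → 0ℚ <ℚ fromℕ x -ℚ fromℕ y
  fromℕ-gap {x} {y} y<x with m≤n⇒∃[o]m+o≡n y<x
  ... | o , refl = subst (0ℚ <ℚ_) (sym gap) (ℚ.positive⁻¹ (fromℕ (suc o)) {{ℚ.normalize-pos (suc o) 1}})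
    where
    open ≡-Reasoning
    gap : fromℕ (suc y + o) -ℚ fromℕ y ≡ fromℕ (suc o)
    gap = begin
      fromℕ (suc y + o) -ℚ fromℕ y                ≡⟨ cong (λ n → fromℕ n -ℚ fromℕ y) (cong suc (+-comm y o)) ⟩
      fromℕ (suc o + y) -ℚ fromℕ y                ≡⟨ cong (_-ℚ fromℕ y) (fromℕ-+ (suc o) y) ⟩
      fromℕ (suc o) +ℚ fromℕ y -ℚ fromℕ y         ≡⟨ //-rightDividesʳ (fromℕ y) (fromℕ (suc o)) ⟩
      fromℕ (suc o)                               ∎

  term≡fromℕ : ∀ n k i → 1 ≤ n → term n k i ≡ fromℕ (lucas (n ∸ i) i * binomial i k)
  term≡fromℕ n k i 1≤n with n ∸ i in n∸i≡
  ... | zero  = cong (λ x → fromℕ (x * binomial i k)) (sym (lucas-< {0} {i} (≤-trans 1≤n (m∸n≡0⇒m≤n n∸i≡))))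
  ... | suc m = trans (cong (λ x → + x /ℚ suc m) numerator) (fromℕ-cancel m (lucas (suc m) i * binomial i k))
    where
    open ≡-Reasoning
    n≡ : n ≡ suc m + i
    n≡ = trans (sym (m∸n+n≡m (<⇒≤ (m∸n≢0⇒n<m {n} {i} (λ n∸i≡0 → 0≢1+n (trans (sym n∸i≡0) n∸i≡)))))) (cong (_+ i) n∸i≡)
    numerator : n * (suc m C i) * (i C k) ≡ suc m * (lucas (suc m) i * binomial i k)
    numerator = begin
      n * (suc m C i) * (i C k)                    ≡⟨ cong₂ (λ x y → n * x * y) (C≡binomial (suc m) i) (C≡binomial i k) ⟩
      n * binomial (suc m) i * binomial i k        ≡⟨ cong (λ x → x * binomial (suc m) i * binomial i k) n≡ ⟩
      (suc m + i) * binomial (suc m) i * binomial i k ≡⟨ cong (_* binomial i k) (lucas-summand m i) ⟩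
      suc m * lucas (suc m) i * binomial i k       ≡⟨ *-assoc (suc m) (lucas (suc m) i) (binomial i k) ⟩
      suc m * (lucas (suc m) i * binomial i k)     ∎

  sumFrom-cong : ∀ a l {f g} → (∀ x → f x ≡ g x) → sumFrom a l f ≡ sumFrom a l g
  sumFrom-cong a zero    f≗g = refl
  sumFrom-cong a (suc l) f≗g = cong₂ _+ℚ_ (f≗g a) (sumFrom-cong (suc a) l f≗g)

  sumFrom-fromℕ : ∀ a l f → sumFrom a l (λ i → fromℕ (f i)) ≡ fromℕ (sumℕ a l f)
  sumFrom-fromℕ a zero    f = refl
  sumFrom-fromℕ a (suc l) f = trans (cong (fromℕ (f a) +ℚ_) (sumFrom-fromℕ (suc a) l f)) (sym (fromℕ-+ (f a) (sumℕ (suc a) l f)))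

  JL≡jl : ∀ n k → 1 ≤ n → JL n k ≡ fromℕ (jl n k)
  JL≡jl n k 1≤n = begin
    sumFrom k L (term n k)                     ≡⟨ sumFrom-cong k L (λ i → term≡fromℕ n k i 1≤n) ⟩
    sumFrom k L (λ i → fromℕ (F i))            ≡⟨ sumFrom-fromℕ k L F ⟩
    fromℕ (sumℕ k L F)                         ≡⟨ cong fromℕ (JL-range-sum≡jl n k) ⟩
    fromℕ (jl n k)                             ∎
    where
    open ≡-Reasoning
    L = suc (n / 2) ∸ k
    F = λ i → lucas (n ∸ i) i * binomial i k

  Δ≡fromℕ-jl : ∀ n k → 1 ≤ n → Δ n k ≡ fromℕ (jl n (suc k)) -ℚ fromℕ (jl n k)
  Δ≡fromℕ-jl n k 1≤n = cong₂ _-ℚ_ (JL≡jl n (suc k) 1≤n) (JL≡jl n k 1≤n)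

open import Defs using (Δ)
open import Data.Nat using (ℕ; _≤_; _+_; _*_; z≤n; s≤s)
open import Data.Nat.Properties using (≤-trans; m≤n+m; m≤n⇒∃[o]m+o≡n)
open import Data.Rational using (0ℚ; _<_)
open import Data.Product using (_,_)
open import Relation.Binary.PropositionalEquality using (refl; subst; sym)
open Natural using (jl-increasing)
open Embedding using (fromℕ-gap; Δ≡fromℕ-jl)

proposition3p3 : (n k : ℕ) → 6 * k + 4 ≤ n → 0ℚ < Δ n k
proposition3p3 n k 6k+4≤n with m≤n⇒∃[o]m+o≡n 6k+4≤n
... | d , refl = subst (0ℚ <_) (sym (Δ≡fromℕ-jl (6 * k + 4 + d) k 1≤n)) (fromℕ-gap (jl-increasing k d))
  where
  1≤n : 1 ≤ 6 * k + 4 + d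
  1≤n = ≤-trans (s≤s z≤n) (≤-trans (m≤n+m 4 (6 * k)) 6k+4≤n)
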